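{- Let $(\delta,K_1,K_2,C_0,C_1)$ be admissible parameters with $C'=C+1$, where $C=\min(C_0,C_1)$, $C'=\max(C_0,C_1)$, and let $M$ be a magic distance. Let $\mathbf C$ be a cycle with distances $d_0,d_1,\dots,d_{2n},x_1,\dots,x_k$ with $n\ge1$ such that $\sum_{i=0}^{2n}d_i>n(C-1)+\sum_{i=1}^kx_i$. If $\mathbf C$ has at least 4 vertices, then $\mathbf C$ has a tension.
   Context: A $\delta$-edge-labelled cycle is a cycle graph (at least 3 vertices) with edge labels in $\{1,\dots,\delta\}$; it "has distances $d_1,\dots,d_m$" if its edges can be listed in some (arbitrary) order with these labels. Two edges are neighbouring if they share a vertex. Parameters: integers with $3\le\delta<\infty$, $1\le K_1\le K_2\le\delta$, $2\delta+2\le C_0,C_1\le3\delta+2$, $C_0$ even, $C_1$ odd. Admissible means either Case II: $C\le2\delta+K_1$, $C=2K_1+2K_2+1$, $K_1+K_2\ge\delta$, $K_1+2K_2\le2\delta-1$, and either $C'=C+1$ or ($C'>C+1$, $K_1=K_2$, $3K_2=2\delta-1$); or Case III: $C>2\delta+K_1$, $K_1+2K_2\ge2\delta-1$, $3K_2\ge2\delta$, if $K_1+2K_2=2\delta-1$ then $C\ge2\delta+K_1+2$, if $C'>C+1$ then $C\ge2\delta+K_2$. Magic distance: $M\in\{1,\dots,\delta\}$ with $\max(K_1,\lceil\delta/2\rceil)\le M\le\min(K_2,\lfloor(C-\delta-1)/2\rfloor)$, such that moreover $M>K_1$ if Case III holds with $K_1+2K_2=2\delta-1$. Operation: $x\oplus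 y=|x-y|$ if $|x-y|>M$; otherwise $\min(x+y,C-1-x-y)$ if this is $<M$; otherwise $M$. A cycle has a tension if it has neighbouring edges with labels $a,b$ such that $a\oplus b\ne M$. -}

module Defs where

open import Data.Nat
open import Data.Nat.Properties using (_≤?_; _<?_)
open import Data.Fin using (Fin; toℕ)
open import Data.Product using (Σ; _×_; ∃; ∃-syntax)
open import Data.Sum using (_⊎_)
open import Data.List using (List; tabulate)
open import Data.List.Relation.Binary.Permutation.Propositional using (_↭_)
open import Relation.Binary.PropositionalEquality using (_≡_; _≢_)
open import Relation.Nullary using (yes; no)

-- Basic constraints on the parameters (δ, K₁, K₂, C₀, C₁), with δ finite.
record Params (δ K₁ K₂ C₀ C₁ : ℕ) : Set where
  field
    δ≥3    : 3 ≤ δ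
    1≤K₁   : 1 ≤ K₁
    K₁≤K₂  : K₁ ≤ K₂
    K₂≤δ   : K₂ ≤ δ
    C₀-lo  : 2 * δ + 2 ≤ C₀
    C₀-hi  : C₀ ≤ 3 * δ + 2
    C₁-lo  : 2 * δ + 2 ≤ C₁
    C₁-hi  : C₁ ≤ 3 * δ + 2
    C₀-even : C₀ % 2 ≡ 0
    C₁-odd  : C₁ % 2 ≡ 1

Cmin : ℕ → ℕ → ℕ
Cmin C₀ C₁ = C₀ ⊓ C₁

Cmax : ℕ → ℕ → ℕ
Cmax C₀ C₁ = C₀ ⊔ C₁

CaseII : (δ K₁ K₂ C C' : ℕ) → Set
CaseII δ K₁ K₂ C C' =
  C ≤ 2 * δ + K₁ × C ≡ 2 * K₁ + 2 * K₂ + 1 × δ ≤ K₁ + K₂ ×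
  K₁ + 2 * K₂ ≤ 2 * δ ∸ 1 ×
  (C' ≡ C + 1 ⊎ (C + 1 < C' × K₁ ≡ K₂ × 3 * K₂ ≡ 2 * δ ∸ 1))

CaseIII : (δ K₁ K₂ C C' : ℕ) → Set
CaseIII δ K₁ K₂ C C' =
  2 * δ + K₁ < C × 2 * δ ∸ 1 ≤ K₁ + 2 * K₂ × 2 * δ ≤ 3 * K₂ ×
  (K₁ + 2 * K₂ ≡ 2 * δ ∸ 1 → 2 * δ + K₁ + 2 ≤ C) ×
  (C + 1 < C' → 2 * δ + K₂ ≤ C)

Admissible : (δ K₁ K₂ C₀ C₁ : ℕ) → Set
Admissible δ K₁ K₂ C₀ C₁ =
  Params δ K₁ K₂ C₀ C₁ ×
  (CaseII δ K₁ K₂ (Cmin C₀ C₁) (Cmax C₀ C₁) ⊎ CaseIII δ K₁ K₂ (Cmin C₀ C₁) (Cmax C₀ C₁))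

IsMagic : (δ K₁ K₂ C₀ C₁ M : ℕ) → Set
IsMagic δ K₁ K₂ C₀ C₁ M =
  1 ≤ M × M ≤ δ ×
  K₁ ⊔ ⌈ δ /2⌉ ≤ M × M ≤ K₂ ⊓ ⌊ (Cmin C₀ C₁ ∸ δ ∸ 1) /2⌋ ×
  ((CaseIII δ K₁ K₂ (Cmin C₀ C₁) (Cmax C₀ C₁) × K₁ + 2 * K₂ ≡ 2 * δ ∸ 1) → K₁ < M)

-- The operation x ⊕ y (depending on M and C). Natural-number subtraction is
-- used for C-1-x-y; it never truncates for labels x, y ≤ δ since C ≥ 2δ+2.
op : (M C x y : ℕ) → ℕ
op M C x y with M <? ∣ x - y ∣
... | yes _ = ∣ x - y ∣
... | no _ with (x + y) ⊓ (C ∸ 1 ∸ x ∸ y) <? M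
...   | yes _ = (x + y) ⊓ (C ∸ 1 ∸ x ∸ y)
...   | no _ = M

-- A δ-edge-labelled cycle: a cycle with len ≥ 3 vertices, whose edges
-- e₀,…,e_{len-1} are listed in cyclic order (eᵢ and eᵢ₊₁ mod len share a vertex).
record LabelledCycle (δ : ℕ) : Set where
  field
    len      : ℕ
    len≥3    : 3 ≤ len
    label    : Fin len → ℕ
    label-lo : ∀ i → 1 ≤ label i
    label-hi : ∀ i → label i ≤ δ
open LabelledCycle public

vertices : ∀ {δ} → LabelledCycle δ → ℕ
vertices c = len c

Neighbouring : (m : ℕ) → Fin m → Fin m → Set
Neighbouring m i j = suc (toℕ i) ≡ toℕ j ⊎ (suc (toℕ i) ≡ m × toℕ j ≡ 0)

HasDistances : ∀ {δ} → LabelledCycle δ → List ℕ → Set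
HasDistances c ds = tabulate (label c) ↭ ds

HasTension : ∀ {δ} → (M C : ℕ) → LabelledCycle δ → Set
HasTension M C c =
  ∃[ i ] ∃[ j ] (Neighbouring (len c) i j × op M C (label c i) (label c j) ≢ M)

module Submission where

open import Defs
open import Data.Nat using (ℕ; _+_; _*_; _∸_; _≤_; _<_; suc)
open import Data.Vec using (Vec; toList; sum)
open import Data.List using (_++_)
open import Relation.Binary.PropositionalEquality using (_≡_)

open import Data.Nat using (zero; z≤n; s≤s; _⊓_; ∣_-_∣; ⌈_/2⌉; ⌊_/2⌋; _<?_; _≟_)
open import Data.Nat.Properties
open import Data.Nat.Tactic.RingSolver using (solve-∀)
open import Data.Fin using (Fin; #_)
import Data.Vec as Vec
open import Data.Vec.Properties using (length-toList)
open import Data.List using (List; []; _∷_; length; tabulate)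
open import Data.List.Properties using (length-++)
import Data.Nat.ListAction as List
open import Data.Nat.ListAction.Properties using (sum-++; sum-↭)
open import Data.List.Relation.Unary.All using (All; []; _∷_)
open import Data.List.Relation.Unary.All.Properties using (tabulate⁺)
open import Data.List.Relation.Binary.Permutation.Propositional
  using (_↭_; ↭-refl; ↭-sym; ↭-trans; refl; prep; swap; trans)
open import Data.List.Relation.Binary.Permutation.Propositional.Properties using (↭-length)
import Data.List.Relation.Binary.Pointwise.Properties as Pointwise
open import Data.List.Relation.Ternary.Interleaving.Propositional
  using (Interleaving; []; consˡ; consʳ; left; right)
open import Data.List.Relation.Ternary.Interleaving.Properties
  using (interleave-length; ++-disjoint)
open import Data.Product using (∃-syntax; ∃₂; _×_; _,_; proj₁)
open import Data.Sum using (inj₁)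
open import Relation.Nullary using (¬_; yes; no; contradiction)
open import Relation.Binary.PropositionalEquality
  using (_≢_; refl; sym; trans; cong; cong₂; subst; subst₂; module ≡-Reasoning)

-- If the pairs (e₀,e₁) and (e₂,e₃) of neighbouring edges both have a ⊕ b = M then, with
-- Q = C - 1, each satisfies |a - b| ≤ M ≤ a + b and a + b + M ≤ Q.  Read the labels as the d's
-- and the x's of the distance list and compare 2 Σ d with |d| Q + 2 Σ x.  Each label on its own
-- respects this comparison since 2δ ≤ Q; a pair of two d's or of two x's does better by 2M, a
-- mixed pair by Q - 2M, and a d outside the pairs by Q - 2δ.  As the number of d's is odd, in
-- every configuration the gains add up to at least Q (using δ ≤ 2M and 2M + δ ≤ Q), so
-- 2 Σ d + Q ≤ (2n + 1) Q + 2 Σ x, which contradicts Σ d > n Q + Σ x.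

m≤o∸n⇒m+n≤o⁺ : ∀ {m n o} → 0 < m → m ≤ o ∸ n → m + n ≤ o
m≤o∸n⇒m+n≤o⁺ {m} {n} {o} 0<m m≤o∸n = m≤o∸n⇒m+n≤o m n≤o m≤o∸n
  where
  n≤o : n ≤ o
  n≤o = <⇒≤ (m∸n≢0⇒n<m λ o∸n≡0 → contradiction (≤-trans 0<m (subst (m ≤_) o∸n≡0 m≤o∸n)) λ ())

record MagicPair (M Q a b : ℕ) : Set where
  field
    a≤b+M   : a ≤ b + M
    b≤a+M   : b ≤ a + M
    M≤a+b   : M ≤ a + b
    a+b+M≤Q : a + b + M ≤ Q

op≡M⇒MagicPair : ∀ {M C a b} → 0 < M → op M C a b ≡ M → MagicPair M (C ∸ 1) a b
op≡M⇒MagicPair {M} {C} {a} {b} 0<M eq with M <? ∣ a - b ∣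
... | yes M<∣a-b∣ = contradiction (sym eq) (<⇒≢ M<∣a-b∣)
... | no M≮∣a-b∣ with (a + b) ⊓ (C ∸ 1 ∸ a ∸ b) <? M
...   | yes small = contradiction eq (<⇒≢ small)
...   | no ¬small = record
  { a≤b+M   = ≤-trans (m≤n+∣m-n∣ a b) (+-monoʳ-≤ b ∣a-b∣≤M)
  ; b≤a+M   = ≤-trans (m≤n+∣n-m∣ b a) (+-monoʳ-≤ a ∣a-b∣≤M)
  ; M≤a+b   = m≤n⊓o⇒m≤n (a + b) _ M≤min
  ; a+b+M≤Q = subst (_≤ C ∸ 1) (+-comm M (a + b)) (m≤o∸n⇒m+n≤o⁺ 0<M M≤Q∸[a+b])
  }
  where
  ∣a-b∣≤M : ∣ a - b ∣ ≤ M
  ∣a-b∣≤M = ≮⇒≥ M≮∣a-b∣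
  M≤min : M ≤ (a + b) ⊓ (C ∸ 1 ∸ a ∸ b)
  M≤min = ≮⇒≥ ¬small
  M≤Q∸[a+b] : M ≤ C ∸ 1 ∸ (a + b)
  M≤Q∸[a+b] = subst (M ≤_) (∸-+-assoc (C ∸ 1) a b) (m≤n⊓o⇒m≤o (a + b) _ M≤min)

module _ {a} {A : Set a} where

  interleaving-++ : ∀ (l r : List A) → Interleaving l r (l ++ r)
  interleaving-++ l r = ++-disjoint (left (Pointwise.refl refl)) (right (Pointwise.refl refl))

  interleaving-++⁻ : ∀ (ys : List A) {zs l r} → Interleaving l r (ys ++ zs) →
    ∃₂ λ l₁ l₂ → ∃₂ λ r₁ r₂ →
      l ≡ l₁ ++ l₂ × r ≡ r₁ ++ r₂ × Interleaving l₁ r₁ ys × Interleaving l₂ r₂ zs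
  interleaving-++⁻ [] σ = [] , _ , [] , _ , refl , refl , [] , σ
  interleaving-++⁻ (y ∷ ys) (consˡ σ) with interleaving-++⁻ ys σ
  ... | l₁ , l₂ , r₁ , r₂ , refl , refl , σ₁ , σ₂ =
    y ∷ l₁ , l₂ , r₁ , r₂ , refl , refl , consˡ σ₁ , σ₂
  interleaving-++⁻ (y ∷ ys) (consʳ σ) with interleaving-++⁻ ys σ
  ... | l₁ , l₂ , r₁ , r₂ , refl , refl , σ₁ , σ₂ =
    l₁ , l₂ , y ∷ r₁ , r₂ , refl , refl , consʳ σ₁ , σ₂

  interleaving-length-left : ∀ {ys l r : List A} → Interleaving l r ys → length l ≤ length ys
  interleaving-length-left {l = l} {r} σ =
    ≤-trans (m≤m+n (length l) (length r)) (≤-reflexive (sym (interleave-length σ)))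

  interleaving-resp-↭ : ∀ {ys zs l r} → ys ↭ zs → Interleaving l r ys →
    ∃₂ λ (l′ r′ : List A) → l ↭ l′ × r ↭ r′ × Interleaving l′ r′ zs
  interleaving-resp-↭ refl σ = _ , _ , ↭-refl , ↭-refl , σ
  interleaving-resp-↭ (prep y p) (consˡ σ) with interleaving-resp-↭ p σ
  ... | _ , _ , l↭ , r↭ , σ′ = _ , _ , prep y l↭ , r↭ , consˡ σ′
  interleaving-resp-↭ (prep y p) (consʳ σ) with interleaving-resp-↭ p σ
  ... | _ , _ , l↭ , r↭ , σ′ = _ , _ , l↭ , prep y r↭ , consʳ σ′
  interleaving-resp-↭ (swap y z p) (consˡ (consˡ σ)) with interleaving-resp-↭ p σ
  ... | _ , _ , l↭ , r↭ , σ′ = _ , _ , swap y z l↭ , r↭ , consˡ (consˡ σ′)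
  interleaving-resp-↭ (swap y z p) (consˡ (consʳ σ)) with interleaving-resp-↭ p σ
  ... | _ , _ , l↭ , r↭ , σ′ = _ , _ , prep y l↭ , prep z r↭ , consʳ (consˡ σ′)
  interleaving-resp-↭ (swap y z p) (consʳ (consˡ σ)) with interleaving-resp-↭ p σ
  ... | _ , _ , l↭ , r↭ , σ′ = _ , _ , prep z l↭ , prep y r↭ , consˡ (consʳ σ′)
  interleaving-resp-↭ (swap y z p) (consʳ (consʳ σ)) with interleaving-resp-↭ p σ
  ... | _ , _ , l↭ , r↭ , σ′ = _ , _ , l↭ , swap y z r↭ , consʳ (consʳ σ′)
  interleaving-resp-↭ (trans p q) σ with interleaving-resp-↭ p σ
  ... | _ , _ , l↭ , r↭ , σ′ with interleaving-resp-↭ q σ′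
  ... | _ , _ , l↭′ , r↭′ , σ″ = _ , _ , ↭-trans l↭ l↭′ , ↭-trans r↭ r↭′ , σ″

-- The labels in l play the role of the d's, those in r the role of the x's.
record Saves (Q s : ℕ) (l r : List ℕ) : Set where
  constructor saves
  field
    bound : 2 * List.sum l + s ≤ length l * Q + 2 * List.sum r

Saves-weaken : ∀ {Q s t l r} → t ≤ s → Saves Q s l r → Saves Q t l r
Saves-weaken {l = l} t≤s (saves bound) = saves (≤-trans (+-monoʳ-≤ (2 * List.sum l) t≤s) bound)

Saves-↭ : ∀ {Q s l l′ r r′} → l ↭ l′ → r ↭ r′ → Saves Q s l r → Saves Q s l′ r′
Saves-↭ {Q} {s} l↭l′ r↭r′ (saves bound) = saves (subst₂ _≤_
  (cong (λ Σl → 2 * Σl + s) (sum-↭ l↭l′))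
  (cong₂ (λ |l| Σr → |l| * Q + 2 * Σr) (↭-length l↭l′) (sum-↭ r↭r′))
  bound)

Saves-++ : ∀ {Q s t l₁ l₂ r₁ r₂} → Saves Q s l₁ r₁ → Saves Q t l₂ r₂ →
  Saves Q (s + t) (l₁ ++ l₂) (r₁ ++ r₂)
Saves-++ {Q} {s} {t} {l₁} {l₂} {r₁} {r₂} (saves bound₁) (saves bound₂) = saves (begin
  2 * List.sum (l₁ ++ l₂) + (s + t)
    ≡⟨ cong (λ Σl → 2 * Σl + (s + t)) (sum-++ l₁ l₂) ⟩
  2 * (List.sum l₁ + List.sum l₂) + (s + t)
    ≡⟨ interchange (List.sum l₁) (List.sum l₂) s t ⟩
  (2 * List.sum l₁ + s) + (2 * List.sum l₂ + t)
    ≤⟨ +-mono-≤ bound₁ bound₂ ⟩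
  (length l₁ * Q + 2 * List.sum r₁) + (length l₂ * Q + 2 * List.sum r₂)
    ≡⟨ collect (length l₁) (length l₂) Q (List.sum r₁) (List.sum r₂) ⟩
  (length l₁ + length l₂) * Q + 2 * (List.sum r₁ + List.sum r₂)
    ≡⟨ cong₂ (λ |l| Σr → |l| * Q + 2 * Σr) (sym (length-++ l₁)) (sym (sum-++ r₁ r₂)) ⟩
  length (l₁ ++ l₂) * Q + 2 * List.sum (r₁ ++ r₂) ∎)
  where
  open ≤-Reasoning
  interchange : ∀ x y s t → 2 * (x + y) + (s + t) ≡ (2 * x + s) + (2 * y + t)
  interchange = solve-∀
  collect : ∀ i j Q x y → (i * Q + 2 * x) + (j * Q + 2 * y) ≡ (i + j) * Q + 2 * (x + y)
  collect = solve-∀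

excess⇒¬Saves : ∀ {Q n l r} → length l ≡ suc (2 * n) → n * Q + List.sum r < List.sum l →
  ¬ Saves Q Q l r
excess⇒¬Saves {Q} {n} {l} {r} |l|≡1+2n excess (saves bound) =
  m+1+n≰m (suc (2 * n) * Q + 2 * List.sum r) (begin
    suc (2 * n) * Q + 2 * List.sum r + 2  ≡⟨ rearrange n Q (List.sum r) ⟩
    2 * suc (n * Q + List.sum r) + Q      ≤⟨ +-monoˡ-≤ Q (*-monoʳ-≤ 2 excess) ⟩
    2 * List.sum l + Q                    ≤⟨ bound ⟩
    length l * Q + 2 * List.sum r         ≡⟨ cong (λ |l| → |l| * Q + 2 * List.sum r) |l|≡1+2n ⟩
    suc (2 * n) * Q + 2 * List.sum r      ∎)
  where
  open ≤-Reasoning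
  rearrange : ∀ n Q Σr → suc (2 * n) * Q + 2 * Σr + 2 ≡ 2 * suc (n * Q + Σr) + Q
  rearrange = solve-∀

-- With b = 0 this also bounds a single d by a ≤ δ.
Saves-singleton : ∀ {Q M a b} → M + M ≤ Q → a ≤ b + M → Saves Q (Q ∸ (M + M)) (a ∷ []) (b ∷ [])
Saves-singleton {Q} {M} {a} {b} 2M≤Q a≤b+M = saves (begin
  2 * (a + 0) + (Q ∸ (M + M))         ≡⟨ cong (λ a′ → 2 * a′ + (Q ∸ (M + M))) (+-identityʳ a) ⟩
  2 * a + (Q ∸ (M + M))               ≤⟨ +-monoˡ-≤ (Q ∸ (M + M)) (*-monoʳ-≤ 2 a≤b+M) ⟩
  2 * (b + M) + (Q ∸ (M + M))         ≡⟨ regroup b M (Q ∸ (M + M)) ⟩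
  M + M + (Q ∸ (M + M)) + 2 * (b + 0) ≡⟨ cong (_+ 2 * (b + 0)) (m+[n∸m]≡n 2M≤Q) ⟩
  Q + 2 * (b + 0)                     ≡⟨ cong (_+ 2 * (b + 0)) (+-identityʳ Q) ⟨
  (Q + 0) + 2 * (b + 0)               ∎)
  where
  open ≤-Reasoning
  regroup : ∀ b M R → 2 * (b + M) + R ≡ M + M + R + 2 * (b + 0)
  regroup = solve-∀

-- A pair whose labels are both d's, or both x's, saves 2M (by a + b + M ≤ Q, resp. M ≤ a + b);
-- a mixed pair saves Q - 2M (by |a - b| ≤ M).  The argument j counts the d's of the pair.
pairSaving : (Q M j : ℕ) → ℕ
pairSaving Q M 1 = Q ∸ (M + M)
pairSaving Q M _ = M + M

MagicPair⇒Saves : ∀ {Q M a b l r} → M + M ≤ Q → MagicPair M Q a b →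
  Interleaving l r (a ∷ b ∷ []) → Saves Q (pairSaving Q M (length l)) l r
MagicPair⇒Saves {Q} {M} {a} {b} _ pair (consˡ (consˡ [])) = saves (begin
  2 * (a + (b + 0)) + (M + M)  ≡⟨ double-sum a b M ⟩
  2 * (a + b + M)              ≤⟨ *-monoʳ-≤ 2 (MagicPair.a+b+M≤Q pair) ⟩
  2 * Q                        ≡⟨ +-identityʳ (2 * Q) ⟨
  2 * Q + 0                    ∎)
  where
  open ≤-Reasoning
  double-sum : ∀ a b M → 2 * (a + (b + 0)) + (M + M) ≡ 2 * (a + b + M)
  double-sum = solve-∀
MagicPair⇒Saves 2M≤Q pair (consˡ (consʳ [])) = Saves-singleton 2M≤Q (MagicPair.a≤b+M pair)
MagicPair⇒Saves 2M≤Q pair (consʳ (consˡ [])) = Saves-singleton 2M≤Q (MagicPair.b≤a+M pair)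
MagicPair⇒Saves {M = M} {a} {b} _ pair (consʳ (consʳ [])) = saves (begin
  M + M              ≤⟨ +-mono-≤ M≤a+b M≤a+b ⟩
  (a + b) + (a + b)  ≡⟨ double-sum a b ⟩
  2 * (a + (b + 0))  ∎)
  where
  open ≤-Reasoning
  M≤a+b : M ≤ a + b
  M≤a+b = MagicPair.M≤a+b pair
  double-sum : ∀ a b → (a + b) + (a + b) ≡ 2 * (a + (b + 0))
  double-sum = solve-∀

-- Each d outside the two pairs saves Q - 2δ; only the first one is counted.
restSaving : (Q δ j : ℕ) → ℕ
restSaving Q δ zero    = 0
restSaving Q δ (suc _) = Q ∸ (δ + δ)

bounded⇒Saves : ∀ {Q δ ys l r} → δ + δ ≤ Q → All (_≤ δ) ys → Interleaving l r ys →
  Saves Q (restSaving Q δ (length l)) l r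
bounded⇒Saves _ [] [] = saves z≤n
bounded⇒Saves {Q} {δ} {y ∷ _} 2δ≤Q (y≤δ ∷ ys≤δ) (consˡ σ) =
  Saves-weaken (m≤m+n _ 0)
    (Saves-++ {r₁ = []} lone-d (Saves-weaken z≤n (bounded⇒Saves 2δ≤Q ys≤δ σ)))
  where
  lone-d : Saves Q (Q ∸ (δ + δ)) (y ∷ []) []
  lone-d = saves (Saves.bound (Saves-singleton {b = 0} 2δ≤Q y≤δ))
bounded⇒Saves 2δ≤Q (_ ∷ ys≤δ) (consʳ σ) =
  Saves-++ {s = 0} (saves z≤n) (bounded⇒Saves 2δ≤Q ys≤δ σ)

module _ {Q M δ : ℕ} (δ≤2M : δ ≤ M + M) (2M+δ≤Q : M + M + δ ≤ Q) where

  private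
    2M≤Q : M + M ≤ Q
    2M≤Q = ≤-trans (m≤m+n (M + M) δ) 2M+δ≤Q

    2δ≤Q : δ + δ ≤ Q
    2δ≤Q = ≤-trans (+-monoˡ-≤ δ δ≤2M) 2M+δ≤Q

    δ≤Q∸2M : δ ≤ Q ∸ (M + M)
    δ≤Q∸2M = m+n≤o⇒m≤o∸n δ (subst (_≤ Q) (+-comm (M + M) δ) 2M+δ≤Q)

    Q≤2δ+rest : ∀ {s} → δ + δ ≤ s → Q ≤ s + (Q ∸ (δ + δ))
    Q≤2δ+rest 2δ≤s = ≤-trans (≤-reflexive (sym (m+[n∸m]≡n 2δ≤Q))) (+-monoˡ-≤ (Q ∸ (δ + δ)) 2δ≤s)

    mixed-then-pure : ∀ t → Q ≤ (Q ∸ (M + M)) + (M + M + t)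
    mixed-then-pure t = ≤-trans (≤-reflexive (sym (m∸n+n≡m 2M≤Q)))
      (+-monoʳ-≤ (Q ∸ (M + M)) (m≤m+n (M + M) t))

    pure-then-mixed : ∀ t → Q ≤ M + M + ((Q ∸ (M + M)) + t)
    pure-then-mixed t = ≤-trans (≤-reflexive (sym (m+[n∸m]≡n 2M≤Q)))
      (+-monoʳ-≤ (M + M) (m≤m+n (Q ∸ (M + M)) t))

    two-mixed : Q ≤ (Q ∸ (M + M)) + ((Q ∸ (M + M)) + (Q ∸ (δ + δ)))
    two-mixed = ≤-trans (Q≤2δ+rest (+-mono-≤ δ≤Q∸2M δ≤Q∸2M))
      (≤-reflexive (+-assoc (Q ∸ (M + M)) (Q ∸ (M + M)) (Q ∸ (δ + δ))))

    two-pure : Q ≤ M + M + (M + M + (Q ∸ (δ + δ)))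
    two-pure = ≤-trans (Q≤2δ+rest (+-mono-≤ δ≤2M δ≤2M))
      (≤-reflexive (+-assoc (M + M) (M + M) (Q ∸ (δ + δ))))

  -- The number of d's is odd, so two mixed or two pure pairs leave a d outside the pairs.
  savings-cover : ∀ {n} j₁ j₂ j₃ → j₁ ≤ 2 → j₂ ≤ 2 → j₁ + (j₂ + j₃) ≡ suc (2 * n) →
    Q ≤ pairSaving Q M j₁ + (pairSaving Q M j₂ + restSaving Q δ j₃)
  savings-cover 1 1 (suc _) _ _ _ = two-mixed
  savings-cover 1 0 _ _ _ _ = mixed-then-pure _
  savings-cover 1 2 _ _ _ _ = mixed-then-pure _
  savings-cover 0 1 _ _ _ _ = pure-then-mixed _
  savings-cover 2 1 _ _ _ _ = pure-then-mixed _
  savings-cover 0 0 (suc _) _ _ _ = two-pure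
  savings-cover 0 2 (suc _) _ _ _ = two-pure
  savings-cover 2 0 (suc _) _ _ _ = two-pure
  savings-cover 2 2 (suc _) _ _ _ = two-pure
  savings-cover {n} 1 1 zero _ _ 2≡1+2n = contradiction 2≡1+2n (even≢odd 1 n)
  savings-cover {n} 0 2 zero _ _ 2≡1+2n = contradiction 2≡1+2n (even≢odd 1 n)
  savings-cover {n} 2 0 zero _ _ 2≡1+2n = contradiction 2≡1+2n (even≢odd 1 n)
  savings-cover {n} 2 2 zero _ _ 4≡1+2n = contradiction 4≡1+2n (even≢odd 2 n)
  savings-cover (suc (suc (suc _))) _ _ (s≤s (s≤s ())) _ _
  savings-cover _ (suc (suc (suc _))) _ _ (s≤s (s≤s ())) _

  magicPairs⇒Saves : ∀ {a b a′ b′ rest ds xs n} → MagicPair M Q a b → MagicPair M Q a′ b′ →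
    All (_≤ δ) rest → (a ∷ b ∷ a′ ∷ b′ ∷ rest) ↭ ds ++ xs → length ds ≡ suc (2 * n) →
    Saves Q Q ds xs
  magicPairs⇒Saves {a} {b} {a′} {b′} {ds = ds} {xs} {n} pair pair′ rest≤δ perm |ds|≡1+2n
    with interleaving-resp-↭ (↭-sym perm) (interleaving-++ ds xs)
  ... | _ , _ , ds↭l , xs↭r , σ with interleaving-++⁻ (a ∷ b ∷ []) σ
  ... | l₁ , _ , _ , _ , refl , refl , σ₁ , σ₂₃ with interleaving-++⁻ (a′ ∷ b′ ∷ []) σ₂₃
  ... | l₂ , l₃ , _ , _ , refl , refl , σ₂ , σ₃ =
    Saves-↭ (↭-sym ds↭l) (↭-sym xs↭r) (Saves-weaken cover
      (Saves-++ (MagicPair⇒Saves 2M≤Q pair σ₁)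
        (Saves-++ (MagicPair⇒Saves 2M≤Q pair′ σ₂) (bounded⇒Saves 2δ≤Q rest≤δ σ₃))))
    where
    lengths : length l₁ + (length l₂ + length l₃) ≡ suc (2 * n)
    lengths = begin
      length l₁ + (length l₂ + length l₃)  ≡⟨ cong (length l₁ +_) (length-++ l₂) ⟨
      length l₁ + length (l₂ ++ l₃)        ≡⟨ length-++ l₁ ⟨
      length (l₁ ++ l₂ ++ l₃)              ≡⟨ ↭-length ds↭l ⟨
      length ds                            ≡⟨ |ds|≡1+2n ⟩
      suc (2 * n)                          ∎
      where open ≡-Reasoning
    cover : Q ≤ pairSaving Q M (length l₁)
              + (pairSaving Q M (length l₂) + restSaving Q δ (length l₃))
    cover = savings-cover {n} (length l₁) (length l₂) (length l₃)
      (interleaving-length-left σ₁) (interleaving-length-left σ₂) lengths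

sum-toList : ∀ {k} (v : Vec ℕ k) → sum v ≡ List.sum (toList v)
sum-toList Vec.[]      = refl
sum-toList (a Vec.∷ v) = cong (a +_) (sum-toList v)

excess⇒tension : ∀ {δ M C m n k} → 0 < M → δ ≤ M + M → M + M + δ ≤ C ∸ 1 →
  (f : Fin m → ℕ) → (∀ i → f i ≤ δ) → 4 ≤ m →
  (d : Vec ℕ (suc (2 * n))) (x : Vec ℕ k) → tabulate f ↭ toList d ++ toList x →
  n * (C ∸ 1) + sum x < sum d →
  ∃[ i ] ∃[ j ] (Neighbouring m i j × op M C (f i) (f j) ≢ M)
excess⇒tension {M = M} {C} {n = n} 0<M δ≤2M 2M+δ≤Q f f≤δ (s≤s (s≤s (s≤s (s≤s _)))) d x perm
  excess
  with op M C (f (# 0)) (f (# 1)) ≟ M | op M C (f (# 2)) (f (# 3)) ≟ M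
... | no tension | _          = # 0 , # 1 , inj₁ refl , tension
... | yes _      | no tension = # 2 , # 3 , inj₁ refl , tension
... | yes magic₀₁ | yes magic₂₃ =
  contradiction bounded (excess⇒¬Saves {n = n} (length-toList d) excess′)
  where
  excess′ : n * (C ∸ 1) + List.sum (toList x) < List.sum (toList d)
  excess′ = subst₂ (λ Σx Σd → n * (C ∸ 1) + Σx < Σd) (sum-toList x) (sum-toList d) excess
  bounded : Saves (C ∸ 1) (C ∸ 1) (toList d) (toList x)
  bounded = magicPairs⇒Saves δ≤2M 2M+δ≤Q {n = n}
    (op≡M⇒MagicPair 0<M magic₀₁) (op≡M⇒MagicPair 0<M magic₂₃) (tabulate⁺ (λ _ → f≤δ _)) perm (length-toList d)

n≤⌈n/2⌉+⌈n/2⌉ : ∀ n → n ≤ ⌈ n /2⌉ + ⌈ n /2⌉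
n≤⌈n/2⌉+⌈n/2⌉ n = subst (_≤ ⌈ n /2⌉ + ⌈ n /2⌉) (⌊n/2⌋+⌈n/2⌉≡n n) (+-monoˡ-≤ ⌈ n /2⌉ (⌊n/2⌋≤⌈n/2⌉ n))

⌊n/2⌋+⌊n/2⌋≤n : ∀ n → ⌊ n /2⌋ + ⌊ n /2⌋ ≤ n
⌊n/2⌋+⌊n/2⌋≤n n = subst (⌊ n /2⌋ + ⌊ n /2⌋ ≤_) (⌊n/2⌋+⌈n/2⌉≡n n) (+-monoʳ-≤ ⌊ n /2⌋ (⌊n/2⌋≤⌈n/2⌉ n))

IsMagic⇒δ≤2M : ∀ {δ K₁ K₂ C₀ C₁ M} → IsMagic δ K₁ K₂ C₀ C₁ M → δ ≤ M + M
IsMagic⇒δ≤2M {δ} {K₁} {M = M} (_ , _ , lower , _) = ≤-trans (n≤⌈n/2⌉+⌈n/2⌉ δ) (+-mono-≤ ⌈δ/2⌉≤M ⌈δ/2⌉≤M)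
  where
  ⌈δ/2⌉≤M : ⌈ δ /2⌉ ≤ M
  ⌈δ/2⌉≤M = ≤-trans (m≤n⊔m K₁ ⌈ δ /2⌉) lower

IsMagic⇒2M+δ≤C∸1 : ∀ {δ K₁ K₂ C₀ C₁ M} → IsMagic δ K₁ K₂ C₀ C₁ M → M + M + δ ≤ Cmin C₀ C₁ ∸ 1
IsMagic⇒2M+δ≤C∸1 {δ} {K₂ = K₂} {C₀} {C₁} {M} (0<M , _ , _ , upper , _) =
  m≤o∸n⇒m+n≤o⁺ (≤-trans 0<M (m≤m+n M M)) (begin
    M + M                                  ≤⟨ +-mono-≤ M≤⌊C∸δ∸1/2⌋ M≤⌊C∸δ∸1/2⌋ ⟩
    ⌊ (C ∸ δ ∸ 1) /2⌋ + ⌊ (C ∸ δ ∸ 1) /2⌋  ≤⟨ ⌊n/2⌋+⌊n/2⌋≤n (C ∸ δ ∸ 1) ⟩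
    C ∸ δ ∸ 1                              ≡⟨ ∸-+-assoc C δ 1 ⟩
    C ∸ (δ + 1)                            ≡⟨ cong (C ∸_) (+-comm δ 1) ⟩
    C ∸ (1 + δ)                            ≡⟨ ∸-+-assoc C 1 δ ⟨
    C ∸ 1 ∸ δ                              ∎)
  where
  open ≤-Reasoning
  C : ℕ
  C = Cmin C₀ C₁
  M≤⌊C∸δ∸1/2⌋ : M ≤ ⌊ (C ∸ δ ∸ 1) /2⌋
  M≤⌊C∸δ∸1/2⌋ = ≤-trans upper (m⊓n≤n K₂ ⌊ (C ∸ δ ∸ 1) /2⌋)

mainTheorem16 : (δ K₁ K₂ C₀ C₁ : ℕ) → Admissible δ K₁ K₂ C₀ C₁ →
    Cmax C₀ C₁ ≡ Cmin C₀ C₁ + 1 →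
    (M : ℕ) → IsMagic δ K₁ K₂ C₀ C₁ M →
    (c : LabelledCycle δ) (n k : ℕ) (d : Vec ℕ (suc (2 * n))) (x : Vec ℕ k) →
    1 ≤ n →
    HasDistances c (toList d ++ toList x) →
    n * (Cmin C₀ C₁ ∸ 1) + sum x < sum d →
    4 ≤ vertices c →
    HasTension M (Cmin C₀ C₁) c
mainTheorem16 δ K₁ K₂ C₀ C₁ _ _ M magic c n k d x _ distances excess 4≤|c| =
  excess⇒tension {n = n} (proj₁ magic) (IsMagic⇒δ≤2M magic) (IsMagic⇒2M+δ≤C∸1 magic)
    (label c) (label-hi c) 4≤|c| d x distances excess
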